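{- Let $p\geq1$ and $n\geq1$. Then $O\Gamma_{n}^{(1,n)}\cong I\Gamma_{n}^{(1,n)}\cong Q_{n}$, $O\Gamma_{n}^{(1,1)}\cong I\Gamma_{n}^{(1,1)}\cong \Gamma_{n}$, and $O\Gamma_{n}^{(p,1)}\cong I\Gamma_{n}^{(p,1)}\cong PN_{p+1}(n)$.
   Context: Words are binary words; $0^{s}$, $1^{s}$ denote runs of $s$ zeros/ones, products denote concatenation, and for a word $b$ and a set of words $\mathcal{A}$, $b\mathcal{A}=\{ba : a\in\mathcal{A}\}$. $Q_n$ is the $n$-dimensional hypercube: vertices are all binary words of length $n$, adjacent iff they differ in exactly one coordinate. The Fibonacci cube $\Gamma_n$ is the subgraph of $Q_n$ induced by the words of length $n$ with no two consecutive $1$s (no factor $11$). For $p\ge1$, the postal network $PN_p(n)$ is the subgraph of $Q_n$ induced by the vertex set defined by: for $n\le p$, all words of length $n$ containing at most one $1$; for $n>p$, $PN_p(n)=0PN_p(n-1)\cup 10^{p-1}PN_p(n-p)$. For positive integers $n,p,r$: $O\Gamma_{n}^{(p,r)}$ is the subgraph of $Q_n$ induced by the words of length $n$ in which any two $1$s are separated by at least $p-1$ zeros and which contain no factor $(10^{p-1})^{r}1$ (no more than $r$ ones each separated from the next by exactly $p-1$ zeros). $I\Gamma_{n}^{(p,r)}$ is the subgraph of $Q_n$ induced by the words of length $n$ in which every maximal block of consecutive $1$s has length at most $r$ and any two distinct blocks of $1$s are separated by at least $p$ zeros. -}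

module Defs where

open import Data.Bool using (Bool; true; false)
open import Data.Nat using (ℕ; zero; suc; _+_; _∸_; _≤_; _<_)
open import Data.Fin as Fin using (Fin; toℕ)
open import Data.Vec using (Vec; lookup; toList)
open import Data.List using (List; []; _∷_; _++_; [_]; replicate; concat; length)
open import Data.Product using (Σ; ∃; ∃-syntax; _×_; _,_; proj₁)
open import Data.Sum using (_⊎_)
open import Data.Unit using (⊤)
open import Relation.Binary.PropositionalEquality using (_≡_; _≢_)
open import Relation.Nullary using (¬_)
open import Function.Bundles using (_⇔_)

Word : ℕ → Set
Word n = Vec Bool n

AdjQ : ∀ {n} → Word n → Word n → Set
AdjQ {n} u v = ∃[ i ] (lookup u i ≢ lookup v i × (∀ (j : Fin n) → j ≢ i → lookup u j ≡ lookup v j))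

Factor : List Bool → List Bool → Set
Factor f w = ∃[ x ] ∃[ y ] (w ≡ x ++ f ++ y)

QP : ∀ {n} → Word n → Set
QP _ = ⊤

FibP : ∀ {n} → Word n → Set
FibP v = ¬ Factor (true ∷ true ∷ []) (toList v)

-- OΓ_n^{(p,r)}: any two 1s separated by at least p-1 zeros
-- (positions i < j of 1s satisfy i + p ≤ j), and no factor (10^{p-1})^r 1.
record OP (p r : ℕ) {n : ℕ} (v : Word n) : Set where
  field
    sep : ∀ (i j : Fin n) → i Fin.< j → lookup v i ≡ true → lookup v j ≡ true →
          toℕ i + p ≤ toℕ j
    noRun : ¬ Factor (concat (replicate r (true ∷ replicate (p ∸ 1) false)) ++ [ true ])
                     (toList v)

LeftBoundary : List Bool → Set
LeftBoundary x = (x ≡ []) ⊎ (∃[ x' ] (x ≡ x' ++ [ false ]))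

RightBoundary : List Bool → Set
RightBoundary y = (y ≡ []) ⊎ (∃[ y' ] (y ≡ false ∷ y'))

-- IΓ_n^{(p,r)}: every maximal block of 1s has length ≤ r, and two distinct
-- (consecutive) blocks of 1s are separated by at least p zeros.
record IP (p r : ℕ) {n : ℕ} (v : Word n) : Set where
  field
    blocks : ∀ (x : List Bool) (k : ℕ) (y : List Bool) →
             toList v ≡ x ++ replicate k true ++ y →
             LeftBoundary x → RightBoundary y → k ≤ r
    gaps : ∀ (x : List Bool) (k : ℕ) (y : List Bool) →
           toList v ≡ x ++ true ∷ replicate k false ++ true ∷ y →
           1 ≤ k → p ≤ k

ones : List Bool → ℕ
ones [] = 0
ones (true ∷ w) = suc (ones w)
ones (false ∷ w) = ones w

-- Postal network PN_p as a set of words (for p ≥ 1):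
-- length ≤ p : at most one 1;
-- length > p : 0·PN_p(n-1) ∪ 10^{p-1}·PN_p(n-p).
data PNList (p : ℕ) : List Bool → Set where
  small : ∀ {w} → length w ≤ p → ones w ≤ 1 → PNList p w
  step0 : ∀ {w} → p < length (false ∷ w) → PNList p w → PNList p (false ∷ w)
  step1 : ∀ {w} → p < length ((true ∷ replicate (p ∸ 1) false) ++ w) → PNList p w →
          PNList p ((true ∷ replicate (p ∸ 1) false) ++ w)

PNP : ℕ → ∀ {n} → Word n → Set
PNP p v = PNList p (toList v)

-- Graph isomorphism between the subgraphs of Q_n induced by the word sets P and R.
-- Vertices are identified by their underlying words.
record _≅_ {n : ℕ} (P R : Word n → Set) : Set where
  field
    to   : Σ (Word n) P → Σ (Word n) R
    from : Σ (Word n) R → Σ (Word n) P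
    to-cong   : ∀ x y → proj₁ x ≡ proj₁ y → proj₁ (to x) ≡ proj₁ (to y)
    from-cong : ∀ x y → proj₁ x ≡ proj₁ y → proj₁ (from x) ≡ proj₁ (from y)
    from-to : ∀ x → proj₁ (from (to x)) ≡ proj₁ x
    to-from : ∀ y → proj₁ (to (from y)) ≡ proj₁ y
    adj : ∀ x y → AdjQ (proj₁ x) (proj₁ y) ⇔ AdjQ (proj₁ (to x)) (proj₁ (to y))

-- All six isomorphisms are the identity on words: in each case the two induced
-- subgraphs of Q_n have the same vertex set. For r = n nothing is excluded, since a
-- forbidden factor would be longer than the word. For r = 1 each family (and also
-- Γ_n for p = 1, and PN_{p+1}(n)) consists exactly of the words in which any two
-- consecutive 1s are separated by at least p zeros; for the postal network this is
-- seen through the automaton that, after reading a 1, counts the zeros still owed.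
module Submission where

open import Defs
open import Data.Nat using (ℕ; zero; suc; _+_; _∸_; _≤_; _<_; z≤n; s≤s; z<s; _≤?_)
open import Data.Nat.Properties
open import Data.Bool using (Bool; true; false)
open import Data.Fin as Fin using (Fin; toℕ)
open import Data.Vec as V using (lookup; toList)
open import Data.Vec.Properties using (length-toList)
open import Data.List using (List; []; _∷_; _++_; [_]; replicate; concat; length)
open import Data.List.Properties
  using (++-assoc; ++-identityʳ; length-++; ∷-injective; length-replicate; length-++-≤ˡ; length-++-≤ʳ)
open import Data.Product using (Σ; ∃; ∃₂; _×_; _,_; proj₁; proj₂)
open import Data.Sum using (inj₁; inj₂)
open import Data.Unit using (⊤; tt)
open import Data.Empty using (⊥; ⊥-elim)
open import Relation.Binary.PropositionalEquality
  using (_≡_; _≢_; refl; sym; trans; cong; subst; subst₂)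
open import Relation.Nullary using (yes; no)
open import Function.Bundles using (_⇔_; mk⇔; Equivalence)
open import Function.Construct.Identity using (⇔-id)

≅-through : ∀ {n} {P R G : Word n → Set} →
            (∀ v → P v ⇔ G v) → (∀ v → R v ⇔ G v) → P ≅ R
≅-through P⇔G R⇔G = record
  { to        = λ x → proj₁ x , from (R⇔G (proj₁ x)) (to (P⇔G (proj₁ x)) (proj₂ x))
  ; from      = λ x → proj₁ x , from (P⇔G (proj₁ x)) (to (R⇔G (proj₁ x)) (proj₂ x))
  ; to-cong   = λ _ _ e → e
  ; from-cong = λ _ _ e → e
  ; from-to   = λ _ → refl
  ; to-from   = λ _ → refl
  ; adj       = λ _ _ → ⇔-id _
  }
  where open Equivalence

factor-length : ∀ {f w : List Bool} → Factor f w → length f ≤ length w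
factor-length {f} (x , y , refl) = ≤-trans (length-++-≤ˡ f) (length-++-≤ʳ (f ++ y) {x})

factor-length-word : ∀ {n f} (v : Word n) → Factor f (toList v) → length f ≤ n
factor-length-word v φ = ≤-trans (factor-length φ) (≤-reflexive (length-toList v))

replicate-+-++ : ∀ {A : Set} (a : A) m n (zs : List A) →
                 replicate m a ++ replicate n a ++ zs ≡ replicate (m + n) a ++ zs
replicate-+-++ a zero    n zs = refl
replicate-+-++ a (suc m) n zs = cong (a ∷_) (replicate-+-++ a m n zs)

split-trailing-ones : ∀ x → ∃₂ λ x' a → x ≡ x' ++ replicate a true × LeftBoundary x'
split-trailing-ones [] = [] , 0 , refl , inj₁ refl
split-trailing-ones (b ∷ x) with split-trailing-ones x
split-trailing-ones (true ∷ x)  | [] , a , e , _ = [] , suc a , cong (true ∷_) e , inj₁ refl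
split-trailing-ones (false ∷ x) | [] , a , e , _ = [ false ] , a , cong (false ∷_) e , inj₂ ([] , refl)
split-trailing-ones (b ∷ x) | c ∷ x' , a , e , inj₁ ()
split-trailing-ones (b ∷ x) | c ∷ x' , a , e , inj₂ (x'' , e') =
  b ∷ c ∷ x' , a , cong (b ∷_) e , inj₂ (b ∷ x'' , cong (b ∷_) e')

split-leading-ones : ∀ y → ∃₂ λ b y' → y ≡ replicate b true ++ y' × RightBoundary y'
split-leading-ones []          = 0 , [] , refl , inj₁ refl
split-leading-ones (false ∷ y) = 0 , false ∷ y , refl , inj₂ (y , refl)
split-leading-ones (true ∷ y) with split-leading-ones y
... | b , y' , e , y'-bd = suc b , y' , cong (true ∷_) e , y'-bd

lookup-after-prefix : ∀ {n} (v : Word n) x z → toList v ≡ x ++ true ∷ z →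
                      Σ (Fin n) λ i → toℕ i ≡ length x × lookup v i ≡ true
lookup-after-prefix V.[] [] z ()
lookup-after-prefix V.[] (_ ∷ _) z ()
lookup-after-prefix (b V.∷ v) [] z eq = Fin.zero , refl , proj₁ (∷-injective eq)
lookup-after-prefix (b V.∷ v) (c ∷ x) z eq with lookup-after-prefix v x z (proj₂ (∷-injective eq))
... | i , i≡|x| , vᵢ = Fin.suc i , cong suc i≡|x| , vᵢ

Gapped : ℕ → List Bool → Set
Gapped p w = ∀ x k y → w ≡ x ++ true ∷ replicate k false ++ true ∷ y → p ≤ k

run₁-unfold : ∀ q (y : List Bool) →
  (concat (replicate 1 (true ∷ replicate q false)) ++ [ true ]) ++ y ≡ true ∷ replicate q false ++ true ∷ y
run₁-unfold q y = cong (true ∷_)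
  (trans (cong (λ t → (t ++ [ true ]) ++ y) (++-identityʳ (replicate q false)))
         (++-assoc (replicate q false) [ true ] y))

run₁-factor : ∀ {p k} w x y → p ≡ suc k → w ≡ x ++ true ∷ replicate k false ++ true ∷ y →
              Factor (concat (replicate 1 (true ∷ replicate (p ∸ 1) false)) ++ [ true ]) w
run₁-factor {k = k} w x y refl eq = x , y , trans eq (cong (x ++_) (sym (run₁-unfold k y)))

module _ (p : ℕ) where

  -- Sparse c w: w is p-gapped and at least c zeros precede its first 1; while reading
  -- a word, c is the number of zeros still owed since the last 1.
  Sparse : ℕ → List Bool → Set
  Sparse c       []          = ⊤
  Sparse c       (false ∷ w) = Sparse (c ∸ 1) w
  Sparse zero    (true ∷ w)  = Sparse p w
  Sparse (suc c) (true ∷ w)  = ⊥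

  Padded : ℕ → List Bool → Set
  Padded c w = ∀ k y → k < c → w ≢ replicate k false ++ true ∷ y

  sparse⇒padded : ∀ c w → Sparse c w → Padded c w
  sparse⇒padded c       []          s zero    y k<c ()
  sparse⇒padded c       []          s (suc k) y k<c ()
  sparse⇒padded c       (false ∷ w) s zero    y k<c ()
  sparse⇒padded (suc c) (false ∷ w) s (suc k) y (s≤s k<c) refl = sparse⇒padded c w s k y k<c refl
  sparse⇒padded zero    w           s k       y ()
  sparse⇒padded (suc c) (true ∷ w)  ()

  sparse⇒gapped : ∀ c w → Sparse c w → Gapped p w
  sparse⇒gapped c       []          s []      k y ()
  sparse⇒gapped c       []          s (_ ∷ _) k y ()
  sparse⇒gapped c       (false ∷ w) s []      k y ()
  sparse⇒gapped c       (false ∷ w) s (_ ∷ x) k y refl = sparse⇒gapped (c ∸ 1) w s x k y refl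
  sparse⇒gapped (suc c) (true ∷ w)  ()
  sparse⇒gapped zero    (true ∷ w)  s []      k y refl =
    ≮⇒≥ (λ k<p → sparse⇒padded p w s k y k<p refl)
  sparse⇒gapped zero    (true ∷ w)  s (_ ∷ x) k y refl = sparse⇒gapped p w s x k y refl

  padded⇒gapped⇒sparse : ∀ c w → Padded c w → Gapped p w → Sparse c w
  padded⇒gapped⇒sparse c [] _ _ = tt
  padded⇒gapped⇒sparse c (false ∷ w) padded gapped =
    padded⇒gapped⇒sparse (c ∸ 1) w
      (λ k y k<c-1 eq → padded (suc k) y (∸1-< c k<c-1) (cong (false ∷_) eq))
      (λ x k y eq → gapped (false ∷ x) k y (cong (false ∷_) eq))
    where
    ∸1-< : ∀ c {k} → k < c ∸ 1 → suc k < c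
    ∸1-< (suc c) k<c = s≤s k<c
  padded⇒gapped⇒sparse (suc c) (true ∷ w) padded gapped = padded zero w z<s refl
  padded⇒gapped⇒sparse zero (true ∷ w) padded gapped =
    padded⇒gapped⇒sparse p w
      (λ k y k<p eq → <⇒≱ k<p (gapped [] k y (cong (true ∷_) eq)))
      (λ x k y eq → gapped (true ∷ x) k y (cong (true ∷_) eq))

  gapped⇒sparse : ∀ w → Gapped p w → Sparse 0 w
  gapped⇒sparse w = padded⇒gapped⇒sparse 0 w (λ _ _ ())

  sparse-spacing : ∀ {n} (v : Word n) c → Sparse c (toList v) →
    (∀ i → lookup v i ≡ true → c ≤ toℕ i) ×
    (∀ i j → i Fin.< j → lookup v i ≡ true → lookup v j ≡ true → toℕ i + p ≤ toℕ j)
  sparse-spacing V.[] c s = (λ ()) , (λ ())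
  sparse-spacing (false V.∷ v) c s = first , spaced
    where
    IH = sparse-spacing v (c ∸ 1) s
    first : ∀ i → lookup (false V.∷ v) i ≡ true → c ≤ toℕ i
    first (Fin.suc i) vᵢ = ≤-trans (m≤n+m∸n c 1) (s≤s (proj₁ IH i vᵢ))
    spaced : ∀ i j → i Fin.< j → lookup (false V.∷ v) i ≡ true → lookup (false V.∷ v) j ≡ true →
             toℕ i + p ≤ toℕ j
    spaced (Fin.suc i) (Fin.suc j) (s≤s i<j) vᵢ vⱼ = s≤s (proj₂ IH i j i<j vᵢ vⱼ)
  sparse-spacing (true V.∷ v) (suc c) ()
  sparse-spacing (true V.∷ v) zero s = (λ _ _ → z≤n) , spaced
    where
    IH = sparse-spacing v p s
    spaced : ∀ i j → i Fin.< j → lookup (true V.∷ v) i ≡ true → lookup (true V.∷ v) j ≡ true →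
             toℕ i + p ≤ toℕ j
    spaced Fin.zero    (Fin.suc j) _         _  vⱼ = m≤n⇒m≤1+n (proj₁ IH j vⱼ)
    spaced (Fin.suc i) (Fin.suc j) (s≤s i<j) vᵢ vⱼ = s≤s (proj₂ IH i j i<j vᵢ vⱼ)

  no-ones⇒sparse : ∀ c w → ones w ≡ 0 → Sparse c w
  no-ones⇒sparse c []          _ = tt
  no-ones⇒sparse c (false ∷ w) e = no-ones⇒sparse (c ∸ 1) w e

  at-most-one-one⇒sparse : ∀ w → ones w ≤ 1 → Sparse 0 w
  at-most-one-one⇒sparse []          _       = tt
  at-most-one-one⇒sparse (false ∷ w) o       = at-most-one-one⇒sparse w o
  at-most-one-one⇒sparse (true ∷ w)  (s≤s o) = no-ones⇒sparse p w (n≤0⇒n≡0 o)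

  zeros-++-sparse : ∀ c w → Sparse 0 w → Sparse c (replicate c false ++ w)
  zeros-++-sparse zero    w s = s
  zeros-++-sparse (suc c) w s = zeros-++-sparse c w s

  PN⇒sparse : ∀ w → PNList (suc p) w → Sparse 0 w
  PN⇒sparse w           (small _ o)       = at-most-one-one⇒sparse w o
  PN⇒sparse (false ∷ w) (step0 _ pn)      = PN⇒sparse w pn
  PN⇒sparse _           (step1 {w} _ pn)  = zeros-++-sparse p w (PN⇒sparse w pn)

  sparse-short⇒no-ones : ∀ c w → Sparse c w → length w ≤ c → ones w ≡ 0
  sparse-short⇒no-ones c       []          _ _ = refl
  sparse-short⇒no-ones (suc c) (false ∷ w) s l = sparse-short⇒no-ones c w s (≤-pred l)
  sparse-short⇒no-ones (suc c) (true ∷ w)  ()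

  sparse-short⇒ones≤1 : ∀ w → Sparse 0 w → length w ≤ suc p → ones w ≤ 1
  sparse-short⇒ones≤1 []          _ _ = z≤n
  sparse-short⇒ones≤1 (false ∷ w) s l = sparse-short⇒ones≤1 w s (m+n≤o⇒n≤o 1 l)
  sparse-short⇒ones≤1 (true ∷ w)  s l
    rewrite sparse-short⇒no-ones p w s (≤-pred l) = ≤-refl

  sparse-split : ∀ c w → Sparse c w → c ≤ length w →
                 ∃ λ w' → w ≡ replicate c false ++ w' × Sparse 0 w'
  sparse-split zero    w           s _ = w , refl , s
  sparse-split (suc c) (false ∷ w) s l with sparse-split c w s (≤-pred l)
  ... | w' , e , s' = w' , cong (false ∷_) e , s'
  sparse-split (suc c) (true ∷ w)  ()

  sparse⇒PN : ∀ m w → length w ≤ m → Sparse 0 w → PNList (suc p) w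
  sparse⇒PN m [] _ _ = small z≤n z≤n
  sparse⇒PN (suc m) (b ∷ w) l s with length (b ∷ w) ≤? suc p
  ... | yes short = small short (sparse-short⇒ones≤1 (b ∷ w) s short)
  sparse⇒PN (suc m) (false ∷ w) l s | no long = step0 (≰⇒> long) (sparse⇒PN m w (≤-pred l) s)
  sparse⇒PN (suc m) (true ∷ w)  l s | no long
    with sparse-split p w s (<⇒≤ (≤-pred (≰⇒> long)))
  ... | w' , refl , s' = step1 (≰⇒> long) (sparse⇒PN m w' |w'|≤m s')
    where
    |w'|≤m : length w' ≤ m
    |w'|≤m = ≤-trans (m≤n+m (length w') p)
               (≤-trans (≤-reflexive (sym (trans (length-++ (replicate p false))
                                                 (cong (_+ length w') (length-replicate p)))))
                        (≤-pred l))

  PN⇔gapped : ∀ w → PNList (suc p) w ⇔ Gapped p w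
  PN⇔gapped w = mk⇔ (λ pn → sparse⇒gapped 0 w (PN⇒sparse w pn))
                    (λ gapped → sparse⇒PN (length w) w ≤-refl (gapped⇒sparse w gapped))

IP⇔gapped : ∀ {p n} (v : Word n) → 1 ≤ p → IP p 1 v ⇔ Gapped p (toList v)
IP⇔gapped {p} v 1≤p = mk⇔ IP⇒gapped gapped⇒IP
  where
  2+b≰1 : ∀ {b} → 2 + b ≤ 1 → ⊥
  2+b≰1 (s≤s ())

  IP⇒gapped : IP p 1 v → Gapped p (toList v)
  IP⇒gapped ip x (suc k) y eq = IP.gaps ip x (suc k) y eq (s≤s z≤n)
  IP⇒gapped ip x zero    y eq with split-trailing-ones x | split-leading-ones y
  ... | x' , a , refl , x'-bd | b , y' , refl , y'-bd =
    ⊥-elim (2+b≰1 (m+n≤o⇒n≤o a (IP.blocks ip x' (a + (2 + b)) y' maximal-block x'-bd y'-bd)))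
    where
    maximal-block : toList v ≡ x' ++ replicate (a + (2 + b)) true ++ y'
    maximal-block = trans eq (trans (++-assoc x' (replicate a true) _)
                                    (cong (x' ++_) (replicate-+-++ true a (2 + b) y')))

  gapped⇒IP : Gapped p (toList v) → IP p 1 v
  gapped⇒IP gapped = record { blocks = blocks ; gaps = λ x k y eq _ → gapped x k y eq }
    where
    blocks : ∀ x k y → toList v ≡ x ++ replicate k true ++ y →
             LeftBoundary x → RightBoundary y → k ≤ 1
    blocks x zero          y eq _ _ = z≤n
    blocks x (suc zero)    y eq _ _ = ≤-refl
    blocks x (suc (suc k)) y eq _ _ = ⊥-elim (<⇒≱ 1≤p (gapped x 0 _ eq))

OP⇔gapped : ∀ {p n} (v : Word n) → 1 ≤ p → OP p 1 v ⇔ Gapped p (toList v)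
OP⇔gapped {p} v 1≤p = mk⇔ OP⇒gapped gapped⇒OP
  where
  OP⇒gapped : OP p 1 v → Gapped p (toList v)
  OP⇒gapped op x k y eq
    with lookup-after-prefix v x _ eq | lookup-after-prefix v (x ++ true ∷ replicate k false) y eq'
    where
    eq' : toList v ≡ (x ++ true ∷ replicate k false) ++ true ∷ y
    eq' = trans eq (sym (++-assoc x (true ∷ replicate k false) (true ∷ y)))
  ... | i , i≡|x| , vᵢ | j , j≡ , vⱼ = ≤-pred (≤∧≢⇒< p≤1+k p≢1+k)
    where
    j≡|x|+1+k : toℕ j ≡ length x + suc k
    j≡|x|+1+k = trans j≡ (trans (length-++ x) (cong (λ t → length x + suc t) (length-replicate k)))
    i<j : i Fin.< j
    i<j = subst₂ _<_ (sym i≡|x|) (sym j≡|x|+1+k) (m<m+n (length x) z<s)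
    p≤1+k : p ≤ suc k
    p≤1+k = +-cancelˡ-≤ (length x) p (suc k)
              (subst₂ (λ a b → a + p ≤ b) i≡|x| j≡|x|+1+k (OP.sep op i j i<j vᵢ vⱼ))
    p≢1+k : p ≢ suc k
    p≢1+k e = OP.noRun op (run₁-factor (toList v) x y e eq)

  gapped⇒OP : Gapped p (toList v) → OP p 1 v
  gapped⇒OP gapped = record
    { sep   = proj₂ (sparse-spacing p v 0 (gapped⇒sparse p (toList v) gapped))
    ; noRun = λ { (x , y , eq) →
        <⇒≱ (∸-monoʳ-< {p} {1} {0} z<s 1≤p)
            (gapped x (p ∸ 1) y (trans eq (cong (x ++_) (run₁-unfold (p ∸ 1) y)))) }
    }

Fib⇔gapped : ∀ {n} (v : Word n) → FibP v ⇔ Gapped 1 (toList v)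
Fib⇔gapped v = mk⇔ fib⇒gapped (λ gapped (x , y , eq) → 1+n≰n (gapped x 0 y eq))
  where
  fib⇒gapped : FibP v → Gapped 1 (toList v)
  fib⇒gapped fib x zero    y eq = ⊥-elim (fib (x , y , eq))
  fib⇒gapped fib x (suc k) y eq = s≤s z≤n

length-ones-run : ∀ n → length (concat (replicate n [ true ]) ++ [ true ]) ≡ suc n
length-ones-run zero    = refl
length-ones-run (suc n) = cong suc (length-ones-run n)

OP-full : ∀ {n} (v : Word n) → OP 1 n v
OP-full {n} v = record
  { sep   = λ i j i<j _ _ → subst (_≤ toℕ j) (+-comm 1 (toℕ i)) i<j
  ; noRun = λ φ → 1+n≰n (subst (_≤ n) (length-ones-run n) (factor-length-word v φ))
  }

IP-full : ∀ {n} (v : Word n) → IP 1 n v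
IP-full v = record
  { blocks = λ x k y eq _ _ → subst (_≤ _) (length-replicate k) (factor-length-word v (x , y , eq))
  ; gaps   = λ _ _ _ _ 1≤k → 1≤k
  }

proposition2p3 : ∀ (p n : ℕ) → 1 ≤ p → 1 ≤ n →
    ((OP 1 n {n} ≅ IP 1 n {n}) × (IP 1 n {n} ≅ QP {n}))
    × ((OP 1 1 {n} ≅ IP 1 1 {n}) × (IP 1 1 {n} ≅ FibP {n}))
    × ((OP p 1 {n} ≅ IP p 1 {n}) × (IP p 1 {n} ≅ PNP (suc p) {n}))
proposition2p3 p n 1≤p _ =
  ( ≅-through OP⇔Q IP⇔Q , ≅-through IP⇔Q (λ _ → ⇔-id _) )
  , ( ≅-through (λ v → OP⇔gapped v ≤-refl) (λ v → IP⇔gapped v ≤-refl)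
    , ≅-through (λ v → IP⇔gapped v ≤-refl) Fib⇔gapped )
  , ( ≅-through (λ v → OP⇔gapped v 1≤p) (λ v → IP⇔gapped v 1≤p)
    , ≅-through (λ v → IP⇔gapped v 1≤p) (λ v → PN⇔gapped p (toList v)) )
  where
  OP⇔Q : ∀ v → OP 1 n v ⇔ QP v
  OP⇔Q v = mk⇔ (λ _ → tt) (λ _ → OP-full v)
  IP⇔Q : ∀ v → IP 1 n v ⇔ QP v
  IP⇔Q v = mk⇔ (λ _ → tt) (λ _ → IP-full v)
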